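{- The map sending a topograph to its river sequence (as a binary word with $L=0$, $R=1$) is a bijection from the set of primitive integer topographs of square discriminant $D\ge4$ (all such discriminants together) to the set of all finite binary words (including the empty word).
   Context: A topograph is a tree drawn in the plane with all vertices of degree 3 whose regions are labelled by integers such that for every edge, if $s,t$ label the regions on either side of it and $r,u$ the other regions at its two endpoints, then $r+u=2(s+t)$; the edge directed from the $r$-end to the $u$-end gets label $s+t-r$. A configuration $[a,b,c]$ is a directed edge with label $b$, region $a$ on its left and $c$ on its right; $b^2-4ac$ is constant on the topograph (its discriminant). Two topographs are identified if there is an orientation-preserving, label-preserving isomorphism between them. Primitive means the gcd of the region labels is $1$. A primitive topograph of discriminant $m^2\ge4$ has exactly two regions labelled $0$ (lakes), which are not adjacent, and the edges separating a positively labelled region from a negatively labelled region form a simple path (the river) of at least one edge joining the two lakes. River sequence: traverse the river from one lake to the other in the direction keeping the positive regions on the left; at each interior vertex of the river record $L$ if the next river edge has the same left (positive) region as the previous one and $R$ if it has the same right (negative) region. (If the river has one edge, the river sequence is the empty word.) -}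

module Defs where

open import Data.Bool using (Bool; true; false)
open import Data.List using (List; []; _∷_)
open import Data.Nat using (ℕ; _≤_)
import Data.Nat as ℕ
open import Data.Nat.Divisibility using (_∣_)
open import Data.Integer using (ℤ; +_; _+_; _-_; _*_; -_; ∣_∣; _>_; _<_)
open import Data.Product using (_×_; _,_; Σ; ∃; ∃-syntax)
open import Relation.Binary.PropositionalEquality using (_≡_)
open import Relation.Binary.Construct.Closure.Equivalence using (EqClosure)

-- A configuration [a,b,c]: a directed edge with label b, region a on its
-- left and region c on its right.
record Config : Set where
  constructor [_,_,_]
  field
    left  : ℤ
    label : ℤ
    right : ℤ
open Config public

disc : Config → ℤ
disc [ a , b , c ] = b * b - + 4 * a * c

-- Region at the tail end (r) and at the head end (u) of the directed edge:
-- b = a + c - r and r + u = 2(a + c).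
tailRegion : Config → ℤ
tailRegion [ a , b , c ] = a + c - b

headRegion : Config → ℤ
headRegion [ a , b , c ] = a + b + c

-- Elementary moves between neighbouring configurations of one topograph.
-- Reverse the direction of the edge.
reverseMove : Config → Config
reverseMove [ a , b , c ] = [ c , - b , a ]

-- Continue through the head vertex along the edge keeping the same left region.
leftMove : Config → Config
leftMove [ a , b , c ] = [ a , + 2 * a + b , a + b + c ]

-- Continue through the head vertex along the edge keeping the same right region.
rightMove : Config → Config
rightMove [ a , b , c ] = [ a + b + c , b + + 2 * c , c ]

data Step : Config → Config → Set where
  rev : ∀ k → Step k (reverseMove k)
  lft : ∀ k → Step k (leftMove k)
  rgt : ∀ k → Step k (rightMove k)

-- Two configurations lie in the same topograph (equivalently, determine
-- identified topographs) iff they are connected by elementary moves.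
-- A topograph is represented by any of its configurations, up to SameTopograph.
SameTopograph : Config → Config → Set
SameTopograph = EqClosure Step

-- Primitive: the gcd of all region labels of the topograph is 1.
-- (Every region is the left region of some configuration.)
Primitive : Config → Set
Primitive k = ∀ (d : ℕ) → (∀ k' → SameTopograph k k' → d ∣ ∣ left k' ∣) → d ≡ 1

SquareDisc : Config → Set
SquareDisc k = ∃[ m ] (disc k ≡ + (m ℕ.* m) × 4 ≤ m ℕ.* m)

RiverEdge : Config → Set
RiverEdge k = (left k > + 0) × (right k < + 0)

-- Binary words: L = false (0), R = true (1).
Word : Set
Word = List Bool

-- RiverWalk k w : starting at river edge k, following the river downstream,
-- the recorded letters are w and the walk ends at a lake (head region 0).
data RiverWalk : Config → Word → Set where
  end   : ∀ k → RiverEdge k → headRegion k ≡ + 0 → RiverWalk k []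
  stepL : ∀ k {w} → RiverEdge k → RiverWalk (leftMove k) w → RiverWalk k (false ∷ w)
  stepR : ∀ k {w} → RiverEdge k → RiverWalk (rightMove k) w → RiverWalk k (true ∷ w)

-- w is the river sequence of the topograph of k: the river starts at a lake
-- (tail region 0) and is traversed keeping the positive regions on the left.
RiverSequence : Config → Word → Set
RiverSequence k w = ∃[ k' ] (SameTopograph k k' × tailRegion k' ≡ + 0 × RiverWalk k' w)

PrimSquare : Config → Set
PrimSquare k = Primitive k × SquareDisc k

module Submission where

open import Defs
open import Data.Bool using (false; true)
open import Data.Empty using (⊥; ⊥-elim)
open import Data.List using ([]; _∷_)
open import Data.Nat as ℕ using (ℕ; zero; suc; s≤s; z≤n; compare; less; equal; greater)
open import Relation.Nullary using (yes; no)
open import Relation.Binary.Definitions using (tri<; tri≈; tri>)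
open import Data.Nat.Coprimality as Coprime using (Coprime)
import Data.Nat.Properties as ℕ
import Data.Nat.Divisibility as ℕ
open import Data.Nat.Induction using (<-wellFounded)
open import Induction.WellFounded using (Acc; acc)
open import Data.Integer as ℤ using (ℤ; +_; -[1+_]; +[1+_]; _+_; _-_; _*_; -_; +<+; -<+)
import Data.Integer.Properties as ℤ
open import Data.Integer.DivMod using (_%ℕ_; _/ℕ_; n%ℕd<d; a≡a%ℕn+[a/ℕn]*n)
open import Data.Integer.Tactic.RingSolver using (solve-∀)
open import Function using (id)
open import Data.Sum as Sum using (_⊎_; inj₁; inj₂; [_,_]′)
open import Data.Product as Product using (_×_; _,_; proj₁; proj₂; ∃-syntax)
open import Data.Integer.Divisibility.Signed
  using (_∣_; divides; ∣-refl; ∣m∣n⇒∣m+n; ∣m∣n⇒∣m-n; ∣m⇒∣-m; ∣n⇒∣m*n; ∣⇒∣ᵤ; ∣ᵤ⇒∣)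
open import Relation.Binary.PropositionalEquality
  using (_≡_; _≢_; refl; sym; trans; cong; cong₂; subst; module ≡-Reasoning)
open import Relation.Binary.Construct.Closure.ReflexiveTransitive using (ε; _◅_)
open import Relation.Binary.Construct.Closure.Symmetric using (fwd; bwd)
import Relation.Binary.Construct.Closure.Equivalence as EqClosure

-- A configuration [a, b, c] is the binary quadratic form a x² + b x y + c y², and
-- the moves act on it by substitutions from SL₂(ℤ).  A square discriminant m² means
-- that the form has a primitive zero; carrying it along by the subtractive Euclidean
-- algorithm leads to a lake [0, ±m, c], then to the lake [0, m, c], and reducing c
-- modulo m along that lake to [0, m, r] with 0 < r < m (r = 0 contradicts
-- primitivity).  Its neighbour [r, r - s, -s], where r + s = m, is the first river
-- edge, and following the river is the Euclidean algorithm on the zero (s, r) of its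
-- form (x + y) (r x - s y): the river sequence is the Stern–Brocot word of s / r.
-- Conversely, a first river edge with river sequence w has its form vanishing at the
-- Stern–Brocot pair of w, which together with primitivity pins it down.  Finally, the
-- first river edges of distinct words lie in distinct topographs, because r modulo m,
-- read off any factorization (α x + β y) (γ x + δ y) of determinant m as the residue
-- with (α, β) ≡ r (γ, δ), is invariant under the moves.


-- Topographs as configurations up to moves

infix 4 _≈_

_≈_ : Config → Config → Set
_≈_ = SameTopograph

≈-sym : ∀ {k k′} → k ≈ k′ → k′ ≈ k
≈-sym = EqClosure.symmetric Step

≈-trans : ∀ {k k′ k″} → k ≈ k′ → k′ ≈ k″ → k ≈ k″
≈-trans = EqClosure.transitive Step

≡⇒≈ : ∀ {k k′} → k ≡ k′ → k ≈ k′
≡⇒≈ refl = ε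

≈-reverseMove : ∀ k → k ≈ reverseMove k
≈-reverseMove k = EqClosure.return (rev k)

≈-leftMove : ∀ k → k ≈ leftMove k
≈-leftMove k = EqClosure.return (lft k)

≈-rightMove : ∀ k → k ≈ rightMove k
≈-rightMove k = EqClosure.return (rgt k)

config-cong : ∀ {a a′ b b′ c c′} → a ≡ a′ → b ≡ b′ → c ≡ c′ → [ a , b , c ] ≡ [ a′ , b′ , c′ ]
config-cong refl refl refl = refl

reverseMove-involutive : ∀ k → reverseMove (reverseMove k) ≡ k
reverseMove-involutive [ a , b , c ] = cong [ a ,_, c ] (ℤ.neg-involutive b)

leftMove-inverse : ∀ k → reverseMove (rightMove (reverseMove (leftMove k))) ≡ k
leftMove-inverse [ a , b , c ] = cong₂ [ a ,_,_] (label≡ a b) (right≡ a b c)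
  where
  label≡ : ∀ a b → - (- (+ 2 * a + b) + + 2 * a) ≡ b
  label≡ = solve-∀
  right≡ : ∀ a b c → a + b + c + - (+ 2 * a + b) + a ≡ c
  right≡ = solve-∀

rightMove-inverse : ∀ k → reverseMove (leftMove (reverseMove (rightMove k))) ≡ k
rightMove-inverse [ a , b , c ] = cong₂ [_,_, c ] (left≡ a b c) (label≡ b c)
  where
  left≡ : ∀ a b c → c + - (b + + 2 * c) + (a + b + c) ≡ a
  left≡ = solve-∀
  label≡ : ∀ b c → - (+ 2 * c + - (b + + 2 * c)) ≡ b
  label≡ = solve-∀

record MoveInvariant (P : Config → Set) : Set where
  field
    reverseMove-pres : ∀ {k} → P k → P (reverseMove k)
    leftMove-pres    : ∀ {k} → P k → P (leftMove k)
    rightMove-pres   : ∀ {k} → P k → P (rightMove k)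

-- Backward steps are undone by forward moves, so forward invariance suffices.
transport : ∀ {P} → MoveInvariant P → ∀ {k k′} → k ≈ k′ → P k → P k′
transport {P} inv = go
  where
  open MoveInvariant inv
  go : ∀ {k k′} → k ≈ k′ → P k → P k′
  go ε p = p
  go (fwd (rev k) ◅ r) p = go r (reverseMove-pres p)
  go (fwd (lft k) ◅ r) p = go r (leftMove-pres p)
  go (fwd (rgt k) ◅ r) p = go r (rightMove-pres p)
  go (bwd (rev k) ◅ r) p = go r (subst P (reverseMove-involutive k) (reverseMove-pres p))
  go (bwd (lft k) ◅ r) p =
    go r (subst P (leftMove-inverse k) (reverseMove-pres (rightMove-pres (reverseMove-pres p))))
  go (bwd (rgt k) ◅ r) p =
    go r (subst P (rightMove-inverse k) (reverseMove-pres (leftMove-pres (reverseMove-pres p))))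


-- Configurations as binary quadratic forms

-- The region labels of the topograph of k are the values of this form at primitive vectors.
value : Config → ℤ → ℤ → ℤ
value [ a , b , c ] x y = a * x * x + b * x * y + c * y * y

value-leftMove : ∀ k x y → value (leftMove k) x y ≡ value k (x + y) y
value-leftMove [ a , b , c ] = identity a b c
  where
  identity : ∀ a b c x y → a * x * x + (+ 2 * a + b) * x * y + (a + b + c) * y * y
                         ≡ a * (x + y) * (x + y) + b * (x + y) * y + c * y * y
  identity = solve-∀

value-rightMove : ∀ k x y → value (rightMove k) x y ≡ value k x (x + y)
value-rightMove [ a , b , c ] = identity a b c
  where
  identity : ∀ a b c x y → (a + b + c) * x * x + (b + + 2 * c) * x * y + c * y * y
                         ≡ a * x * x + b * x * (x + y) + c * (x + y) * (x + y)
  identity = solve-∀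

value-reverseMove : ∀ k x y → value (reverseMove k) x y ≡ value k (- y) x
value-reverseMove [ a , b , c ] = identity a b c
  where
  identity : ∀ a b c x y → c * x * x + - b * x * y + a * y * y
                         ≡ a * - y * - y + b * - y * x + c * x * x
  identity = solve-∀

factored : ℤ → ℤ → ℤ → ℤ → Config
factored α β γ δ = [ α * γ , α * δ + β * γ , β * δ ]

value-factored : ∀ α β γ δ x y → value (factored α β γ δ) x y ≡ (α * x + β * y) * (γ * x + δ * y)
value-factored = identity
  where
  identity : ∀ α β γ δ x y → α * γ * x * x + (α * δ + β * γ) * x * y + β * δ * y * y
                           ≡ (α * x + β * y) * (γ * x + δ * y)
  identity = solve-∀

factored-leftMove : ∀ α β γ δ → leftMove (factored α β γ δ) ≡ factored α (α + β) γ (γ + δ)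
factored-leftMove α β γ δ = cong₂ [ α * γ ,_,_] (label≡ α β γ δ) (right≡ α β γ δ)
  where
  label≡ : ∀ α β γ δ → + 2 * (α * γ) + (α * δ + β * γ) ≡ α * (γ + δ) + (α + β) * γ
  label≡ = solve-∀
  right≡ : ∀ α β γ δ → α * γ + (α * δ + β * γ) + β * δ ≡ (α + β) * (γ + δ)
  right≡ = solve-∀

factored-rightMove : ∀ α β γ δ → rightMove (factored α β γ δ) ≡ factored (α + β) β (γ + δ) δ
factored-rightMove α β γ δ = cong₂ [_,_, β * δ ] (left≡ α β γ δ) (label≡ α β γ δ)
  where
  left≡ : ∀ α β γ δ → α * γ + (α * δ + β * γ) + β * δ ≡ (α + β) * (γ + δ)
  left≡ = solve-∀
  label≡ : ∀ α β γ δ → α * δ + β * γ + + 2 * (β * δ) ≡ (α + β) * δ + β * (γ + δ)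
  label≡ = solve-∀

factored-reverseMove : ∀ α β γ δ → reverseMove (factored α β γ δ) ≡ factored β (- α) δ (- γ)
factored-reverseMove α β γ δ = cong₂ [ β * δ ,_,_] (label≡ α β γ δ) (right≡ α γ)
  where
  label≡ : ∀ α β γ δ → - (α * δ + β * γ) ≡ β * - γ + - α * δ
  label≡ = solve-∀
  right≡ : ∀ α γ → α * γ ≡ - α * - γ
  right≡ = solve-∀

det-leftMove : ∀ α β γ δ → α * (γ + δ) - (α + β) * γ ≡ α * δ - β * γ
det-leftMove = solve-∀

det-rightMove : ∀ α β γ δ → (α + β) * δ - β * (γ + δ) ≡ α * δ - β * γ
det-rightMove = solve-∀

det-reverseMove : ∀ α β γ δ → β * - γ - - α * δ ≡ α * δ - β * γ
det-reverseMove = solve-∀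

disc-invariant : ∀ D → MoveInvariant (λ k → disc k ≡ D)
disc-invariant D = record
  { reverseMove-pres = λ { {[ a , b , c ]} → trans (reverse≡ a b c) }
  ; leftMove-pres    = λ { {[ a , b , c ]} → trans (left≡ a b c) }
  ; rightMove-pres   = λ { {[ a , b , c ]} → trans (right≡ a b c) }
  }
  where
  reverse≡ : ∀ a b c → - b * - b - + 4 * c * a ≡ b * b - + 4 * a * c
  reverse≡ = solve-∀
  left≡ : ∀ a b c → (+ 2 * a + b) * (+ 2 * a + b) - + 4 * a * (a + b + c) ≡ b * b - + 4 * a * c
  left≡ = solve-∀
  right≡ : ∀ a b c → (b + + 2 * c) * (b + + 2 * c) - + 4 * (a + b + c) * c ≡ b * b - + 4 * a * c
  right≡ = solve-∀

CommonDivisor : ℤ → Config → Set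
CommonDivisor t k = t ∣ left k × t ∣ label k × t ∣ right k

commonDivisor-invariant : ∀ t → MoveInvariant (CommonDivisor t)
commonDivisor-invariant t = record
  { reverseMove-pres = λ (t∣a , t∣b , t∣c) → t∣c , ∣m⇒∣-m t∣b , t∣a
  ; leftMove-pres    = λ (t∣a , t∣b , t∣c) →
      t∣a , ∣m∣n⇒∣m+n (∣n⇒∣m*n (+ 2) t∣a) t∣b , ∣m∣n⇒∣m+n (∣m∣n⇒∣m+n t∣a t∣b) t∣c
  ; rightMove-pres   = λ (t∣a , t∣b , t∣c) →
      ∣m∣n⇒∣m+n (∣m∣n⇒∣m+n t∣a t∣b) t∣c , ∣m∣n⇒∣m+n t∣b (∣n⇒∣m*n (+ 2) t∣c) , t∣c
  }

primitive-commonDivisor : ∀ {k k′} → Primitive k → k ≈ k′ → ∀ t → CommonDivisor (+ t) k′ → t ≡ 1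
primitive-commonDivisor k-primitive k≈k′ t t∣k′ = k-primitive t λ k″ k≈k″ →
  ∣⇒∣ᵤ (proj₁ (transport (commonDivisor-invariant (+ t)) (≈-trans (≈-sym k≈k′) k≈k″) t∣k′))


-- The subtractive Euclidean algorithm

-- R x y speaks about the pair of positive integers (1 + x, 1 + y); every such
-- pair arises from a diagonal one by repeatedly adding one entry to the other.
positivePairInduction : (R : ℕ → ℕ → Set) →
  (∀ n → R n n) →
  (∀ {x y} → R x y → R (x ℕ.+ suc y) y) →
  (∀ {x y} → R x y → R x (x ℕ.+ suc y)) →
  ∀ x y → R x y
positivePairInduction R diagonal addRight addLeft x y = go x y (<-wellFounded (x ℕ.+ y))
  where
  go : ∀ x y → Acc ℕ._<_ (x ℕ.+ y) → R x y
  go x y (acc rec) with compare x y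
  ... | less .x e =
    subst (R x) (ℕ.+-suc x e) (addLeft (go x e (rec (ℕ.+-monoʳ-< x (ℕ.m<n+m e (s≤s z≤n))))))
  ... | equal .x = diagonal x
  ... | greater .y e =
    subst (λ z → R z y) (trans (ℕ.+-suc e y) (cong suc (ℕ.+-comm e y)))
      (addRight (go e y (rec (s≤s (ℕ.≤-trans (ℕ.≤-reflexive (ℕ.+-comm e y)) (ℕ.m≤m+n (y ℕ.+ e) y))))))

-- (γ, δ) transforms like the coefficients of the linear form γ x + δ y.
record CoordinateAction (P : Config → ℤ → ℤ → Set) : Set where
  field
    leftMove-act    : ∀ {k γ δ} → P k γ δ → P (leftMove k) γ (γ + δ)
    rightMove-act   : ∀ {k γ δ} → P k γ δ → P (rightMove k) (γ + δ) δ
    reverseMove-act : ∀ {k γ δ} → P k γ δ → P (reverseMove k) δ (- γ)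

module Descent {P : Config → ℤ → ℤ → Set} (act : CoordinateAction P) where
  open CoordinateAction act

  Descends : Config → Set
  Descends k = ∃[ k′ ] ∃[ d ] (k ≈ k′ × P k′ (+ 0) -[1+ d ])

  ≈-descends : ∀ {k k′} → k ≈ k′ → Descends k′ → Descends k
  ≈-descends k≈k′ (k″ , d , k′≈k″ , p) = k″ , d , ≈-trans k≈k′ k′≈k″ , p

  negate : ∀ {k γ δ} → P k γ δ → P k (- γ) (- δ)
  negate {k} p = subst (λ k → P k _ _) (reverseMove-involutive k) (reverseMove-act (reverseMove-act p))

  descend-+- : ∀ x y {k} → P k +[1+ x ] -[1+ y ] → Descends k
  descend-+- = positivePairInduction R diagonal addRight addLeft
    where
    R : ℕ → ℕ → Set
    R x y = ∀ {k} → P k +[1+ x ] -[1+ y ] → Descends k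
    cancelʳ : ∀ a b → a + b + - b ≡ a
    cancelʳ = solve-∀
    cancelˡ : ∀ a b → a + - (a + b) ≡ - b
    cancelˡ = solve-∀
    diagonal : ∀ n → R n n
    diagonal n {k} p =
      rightMove k , n , ≈-rightMove k ,
      subst (λ γ → P (rightMove k) γ -[1+ n ]) (ℤ.n⊖n≡0 (suc n)) (rightMove-act p)
    addRight : ∀ {x y} → R x y → R (x ℕ.+ suc y) y
    addRight {x} {y} descends {k} p = ≈-descends (≈-rightMove k) (descends
      (subst (λ γ → P (rightMove k) γ -[1+ y ]) (cancelʳ +[1+ x ] +[1+ y ]) (rightMove-act p)))
    addLeft : ∀ {x y} → R x y → R x (x ℕ.+ suc y)
    addLeft {x} {y} descends {k} p = ≈-descends (≈-leftMove k) (descends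
      (subst (P (leftMove k) +[1+ x ]) (cancelˡ +[1+ x ] +[1+ y ]) (leftMove-act p)))

  descend-+ : ∀ g δ {k} → P k +[1+ g ] δ → Descends k
  descend-+ g (+ zero)   {k} p = reverseMove k , g , ≈-reverseMove k , reverseMove-act p
  descend-+ g +[1+ d ]   {k} p = ≈-descends (≈-reverseMove k) (descend-+- d g (reverseMove-act p))
  descend-+ g -[1+ d ]       p = descend-+- g d p

  descend : ∀ {k γ δ} → γ ≢ + 0 → P k γ δ → Descends k
  descend {γ = + zero}   γ≢0 _ = ⊥-elim (γ≢0 refl)
  descend {γ = +[1+ g ]} _   p = descend-+ g _ p
  descend {γ = -[1+ g ]} _   p = descend-+ g _ (negate p)


-- Following the river

VanishesAt : Config → ℕ × ℕ → Set
VanishesAt k (x , y) = value k +[1+ x ] +[1+ y ] ≡ + 0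

private
  i≡j+v∧v≡0⇒i≡j : ∀ {i j v} → i ≡ j + v → v ≡ + 0 → i ≡ j
  i≡j+v∧v≡0⇒i≡j {j = j} i≡j+v refl = trans i≡j+v (ℤ.+-identityʳ j)

-- On a river edge vanishing at (x, y) with x, y > 0 the head region has the sign of
-- y - x, since (a + b + c) x y = (x - y) (c y - a x) + value k x y.
headRegion-negative : ∀ {k} x y → RiverEdge k →
  value k (+[1+ x ] + +[1+ y ]) +[1+ y ] ≡ + 0 → headRegion k ℤ.< + 0
headRegion-negative {[ +[1+ a ] , b , -[1+ c ] ]} x y (+<+ _ , -<+) v≡0 =
  ℤ.*-cancelʳ-<-nonNeg ((X + Y) * Y)
    (subst (ℤ._< + 0) (sym (i≡j+v∧v≡0⇒i≡j (identity +[1+ a ] b -[1+ c ] X Y) v≡0)) -<+)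
  where
  X Y : ℤ
  X = +[1+ x ]
  Y = +[1+ y ]
  identity : ∀ a b c X Y → (a + b + c) * ((X + Y) * Y)
    ≡ X * (c * Y - a * (X + Y)) + (a * (X + Y) * (X + Y) + b * (X + Y) * Y + c * Y * Y)
  identity = solve-∀

headRegion-positive : ∀ {k} x y → RiverEdge k →
  value k +[1+ x ] (+[1+ x ] + +[1+ y ]) ≡ + 0 → + 0 ℤ.< headRegion k
headRegion-positive {[ +[1+ a ] , b , -[1+ c ] ]} x y (+<+ _ , -<+) v≡0 =
  ℤ.*-cancelʳ-<-nonNeg (X * (X + Y))
    (subst (+ 0 ℤ.<_) (sym (i≡j+v∧v≡0⇒i≡j (identity +[1+ a ] b -[1+ c ] X Y) v≡0)) (+<+ (s≤s z≤n)))
  where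
  X Y : ℤ
  X = +[1+ x ]
  Y = +[1+ y ]
  identity : ∀ a b c X Y → (a + b + c) * (X * (X + Y))
    ≡ Y * (a * X - c * (X + Y)) + (a * X * X + b * X * (X + Y) + c * (X + Y) * (X + Y))
  identity = solve-∀

headRegion-zero : ∀ {k} x → value k +[1+ x ] +[1+ x ] ≡ + 0 → headRegion k ≡ + 0
headRegion-zero {[ a , b , c ]} x v≡0 =
  [ id , (λ ()) ]′ (ℤ.i*j≡0⇒i≡0∨j≡0 (a + b + c) (trans (identity a b c +[1+ x ]) v≡0))
  where
  identity : ∀ a b c X → (a + b + c) * (X * X) ≡ a * X * X + b * X * X + c * X * X
  identity = solve-∀

riverEdge-leftMove : ∀ {k} x y → RiverEdge k →
  value k (+[1+ x ] + +[1+ y ]) +[1+ y ] ≡ + 0 → RiverEdge (leftMove k)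
riverEdge-leftMove x y e v≡0 = proj₁ e , headRegion-negative x y e v≡0

riverEdge-rightMove : ∀ {k} x y → RiverEdge k →
  value k +[1+ x ] (+[1+ x ] + +[1+ y ]) ≡ + 0 → RiverEdge (rightMove k)
riverEdge-rightMove x y e v≡0 = headRegion-positive x y e v≡0 , proj₂ e

riverWalk-exists : ∀ x y {k} → RiverEdge k → VanishesAt k (x , y) → ∃[ w ] RiverWalk k w
riverWalk-exists = positivePairInduction R diagonal addRight addLeft
  where
  R : ℕ → ℕ → Set
  R x y = ∀ {k} → RiverEdge k → VanishesAt k (x , y) → ∃[ w ] RiverWalk k w
  diagonal : ∀ n → R n n
  diagonal n {k} e v≡0 = [] , end k e (headRegion-zero {k} n v≡0)
  addRight : ∀ {x y} → R x y → R (x ℕ.+ suc y) y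
  addRight {x} {y} walk {k} e v≡0
    with walk (riverEdge-leftMove x y e v≡0) (trans (value-leftMove k _ _) v≡0)
  ... | w , walk′ = false ∷ w , stepL k e walk′
  addLeft : ∀ {x y} → R x y → R x (x ℕ.+ suc y)
  addLeft {x} {y} walk {k} e v≡0
    with walk (riverEdge-rightMove x y e v≡0) (trans (value-rightMove k _ _) v≡0)
  ... | w , walk′ = true ∷ w , stepR k e walk′

-- The positive pair (1 + x, 1 + y), encoded as (x , y), at which the form of the
-- first edge of a river with sequence w vanishes.
sternBrocot : Word → ℕ × ℕ
sternBrocot []          = 0 , 0
sternBrocot (false ∷ w) = let (x , y) = sternBrocot w in x ℕ.+ suc y , y
sternBrocot (true ∷ w)  = let (x , y) = sternBrocot w in x , x ℕ.+ suc y

riverWalk-sternBrocot : ∀ w {k} → RiverEdge k → VanishesAt k (sternBrocot w) → RiverWalk k w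
riverWalk-sternBrocot [] {k} e v≡0 = end k e (headRegion-zero {k} 0 v≡0)
riverWalk-sternBrocot (false ∷ w) {k} e v≡0 =
  stepL k e (riverWalk-sternBrocot w (riverEdge-leftMove _ _ e v≡0) (trans (value-leftMove k _ _) v≡0))
riverWalk-sternBrocot (true ∷ w) {k} e v≡0 =
  stepR k e (riverWalk-sternBrocot w (riverEdge-rightMove _ _ e v≡0) (trans (value-rightMove k _ _) v≡0))

riverWalk-vanishes : ∀ {k w} → RiverWalk k w → VanishesAt k (sternBrocot w)
riverWalk-vanishes (end [ a , b , c ] _ h≡0) = trans (identity a b c) h≡0
  where
  identity : ∀ a b c → a * + 1 * + 1 + b * + 1 * + 1 + c * + 1 * + 1 ≡ a + b + c
  identity = solve-∀
riverWalk-vanishes (stepL k _ walk) = trans (sym (value-leftMove k _ _)) (riverWalk-vanishes walk)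
riverWalk-vanishes (stepR k _ walk) = trans (sym (value-rightMove k _ _)) (riverWalk-vanishes walk)

sternBrocot-coprime : ∀ w → Coprime (suc (proj₁ (sternBrocot w))) (suc (proj₂ (sternBrocot w)))
sternBrocot-coprime [] = Coprime.1-coprimeTo 1
sternBrocot-coprime (false ∷ w) =
  subst (λ n → Coprime n (suc y)) (ℕ.+-comm (suc y) (suc x)) (Coprime.coprime-+ (sternBrocot-coprime w))
  where
  x y : ℕ
  x = proj₁ (sternBrocot w)
  y = proj₂ (sternBrocot w)
sternBrocot-coprime (true ∷ w) = Coprime.sym (Coprime.coprime-+ (Coprime.sym (sternBrocot-coprime w)))

private
  letters-differ : ∀ {x y x′ y′} → x ℕ.+ suc y ≡ x′ → y ≡ x′ ℕ.+ suc y′ → ⊥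
  letters-differ {x} {y} {x′} eq₁ eq₂ =
    ℕ.<-asym (subst (y ℕ.<_) eq₁ (ℕ.m≤n+m (suc y) x)) (subst (x′ ℕ.<_) (sym eq₂) (ℕ.m<m+n x′ (s≤s z≤n)))

sternBrocot-injective : ∀ w w′ → sternBrocot w ≡ sternBrocot w′ → w ≡ w′
sternBrocot-injective []          []           _  = refl
sternBrocot-injective []          (false ∷ w′) eq = ⊥-elim (ℕ.m+1+n≢0 _ (sym (cong proj₁ eq)))
sternBrocot-injective []          (true ∷ w′)  eq = ⊥-elim (ℕ.m+1+n≢0 _ (sym (cong proj₂ eq)))
sternBrocot-injective (false ∷ w) []           eq = ⊥-elim (ℕ.m+1+n≢0 _ (cong proj₁ eq))
sternBrocot-injective (true ∷ w)  []           eq = ⊥-elim (ℕ.m+1+n≢0 _ (cong proj₂ eq))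
sternBrocot-injective (false ∷ w) (true ∷ w′)  eq = ⊥-elim (letters-differ (cong proj₁ eq) (cong proj₂ eq))
sternBrocot-injective (true ∷ w)  (false ∷ w′) eq =
  ⊥-elim (letters-differ (sym (cong proj₁ eq)) (sym (cong proj₂ eq)))
sternBrocot-injective (false ∷ w) (false ∷ w′) eq =
  cong (false ∷_) (sternBrocot-injective w w′ (cong₂ _,_
  (ℕ.+-cancelʳ-≡ _ _ _ (trans (cong proj₁ eq) (cong (λ y → _ ℕ.+ suc y) (sym (cong proj₂ eq)))))
  (cong proj₂ eq)))
sternBrocot-injective (true ∷ w) (true ∷ w′) eq =
  cong (true ∷_) (sternBrocot-injective w w′ (cong₂ _,_
  (cong proj₁ eq)
  (ℕ.suc-injective (ℕ.+-cancelˡ-≡ _ _ _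
    (trans (cong proj₂ eq) (cong (λ x → x ℕ.+ _) (sym (cong proj₁ eq))))))))

-- The river edge leaving a lake whose form vanishes at (x, y).
riverStart : ℤ → ℤ → Config
riverStart x y = [ y , y - x , - x ]

riverStart-tailRegion : ∀ x y → tailRegion (riverStart x y) ≡ + 0
riverStart-tailRegion = identity
  where
  identity : ∀ x y → y + - x - (y - x) ≡ + 0
  identity = solve-∀

riverStart-vanishes : ∀ x y → value (riverStart x y) x y ≡ + 0
riverStart-vanishes = identity
  where
  identity : ∀ x y → y * x * x + (y - x) * x * y + - x * y * y ≡ + 0
  identity = solve-∀

riverStart-disc : ∀ x y → disc (riverStart x y) ≡ (x + y) * (x + y)
riverStart-disc = identity
  where
  identity : ∀ x y → (y - x) * (y - x) - + 4 * y * - x ≡ (x + y) * (x + y)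
  identity = solve-∀

riverStart-riverEdge : ∀ x y → RiverEdge (riverStart +[1+ x ] +[1+ y ])
riverStart-riverEdge x y = +<+ (s≤s z≤n) , -<+

firstRiverEdge : Word → Config
firstRiverEdge w = riverStart +[1+ proj₁ (sternBrocot w) ] +[1+ proj₂ (sternBrocot w) ]

firstRiverEdge-riverSequence : ∀ w → RiverSequence (firstRiverEdge w) w
firstRiverEdge-riverSequence w =
  firstRiverEdge w , ε , riverStart-tailRegion X Y ,
  riverWalk-sternBrocot w (riverStart-riverEdge _ _) (riverStart-vanishes X Y)
  where
  X Y : ℤ
  X = +[1+ proj₁ (sternBrocot w) ]
  Y = +[1+ proj₂ (sternBrocot w) ]

firstRiverEdge-primSquare : ∀ w → PrimSquare (firstRiverEdge w)
firstRiverEdge-primSquare w = coprime-regions , m , square , ℕ.*-mono-≤ 2≤m 2≤m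
  where
  x y m : ℕ
  x = proj₁ (sternBrocot w)
  y = proj₂ (sternBrocot w)
  m = suc x ℕ.+ suc y
  2≤m : 2 ℕ.≤ m
  2≤m = s≤s (ℕ.≤-trans (s≤s z≤n) (ℕ.m≤n+m (suc y) x))
  -- The left regions of the edge and of its reverse are 1 + y and -(1 + x).
  coprime-regions : Primitive (firstRiverEdge w)
  coprime-regions d divides-left =
    sternBrocot-coprime w (divides-left _ (≈-reverseMove _) , divides-left _ ε)
  square : disc (firstRiverEdge w) ≡ + (m ℕ.* m)
  square = trans (riverStart-disc +[1+ x ] +[1+ y ]) (sym (ℤ.pos-* m m))


-- Every primitive topograph of square discriminant has a river

zeroVector-action : CoordinateAction (λ k γ δ → value k δ (- γ) ≡ + 0)
zeroVector-action = record
  { leftMove-act    = λ {k} {γ} {δ} v≡0 →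
      trans (value-leftMove k _ _) (trans (cong (λ x → value k x (- γ)) (cancel γ δ)) v≡0)
  ; rightMove-act   = λ {k} {γ} {δ} v≡0 →
      trans (value-rightMove k _ _) (trans (cong (value k δ) (cancel′ γ δ)) v≡0)
  ; reverseMove-act = λ {k} {γ} {δ} v≡0 →
      trans (value-reverseMove k _ _) (trans (cong (λ x → value k x (- γ)) (ℤ.neg-involutive δ)) v≡0)
  }
  where
  cancel : ∀ γ δ → γ + δ + - γ ≡ δ
  cancel = solve-∀
  cancel′ : ∀ γ δ → δ + - (γ + δ) ≡ - γ
  cancel′ = solve-∀

vanishes-on-axis : ∀ {k} d → value k -[1+ d ] (+ 0) ≡ + 0 → left k ≡ + 0
vanishes-on-axis {[ a , b , c ]} d v≡0 =
  [ id , (λ ()) ]′ (ℤ.i*j≡0⇒i≡0∨j≡0 a (trans (identity a b c -[1+ d ]) v≡0))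
  where
  identity : ∀ a b c x → a * (x * x) ≡ a * x * x + b * x * + 0 + c * + 0 * + 0
  identity = solve-∀

-- A form with square discriminant m² vanishes at (m - b, 2a).
lake-reachable : ∀ {k m} → disc k ≡ + (m ℕ.* m) → ∃[ k′ ] (k ≈ k′ × left k′ ≡ + 0)
lake-reachable {[ a , b , c ]} {m} disc≡ with a ℤ.≟ + 0
... | yes a≡0 = _ , ε , a≡0
... | no a≢0 with Descent.descend zeroVector-action γ≢0 vanishes
  where
  γ≢0 : - (+ 2 * a) ≢ + 0
  γ≢0 eq = a≢0 ([ (λ ()) , id ]′ (ℤ.i*j≡0⇒i≡0∨j≡0 (+ 2) (ℤ.neg-injective eq)))
  identity : ∀ a b c M →
    a * (M - b) * (M - b) + b * (M - b) * - - (+ 2 * a) + c * - - (+ 2 * a) * - - (+ 2 * a)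
    ≡ a * (M * M - (b * b - + 4 * a * c))
  identity = solve-∀
  cancel : ∀ a M → a * (M - M) ≡ + 0
  cancel = solve-∀
  vanishes : value [ a , b , c ] (+ m - b) (- - (+ 2 * a)) ≡ + 0
  vanishes = trans (identity a b c (+ m))
    (trans (cong (λ D → a * (+ m * + m - D)) (trans disc≡ (ℤ.pos-* m m))) (cancel a (+ m * + m)))
... | k′ , d , k≈k′ , v≡0 = k′ , k≈k′ , vanishes-on-axis {k′} d v≡0

private
  square-injective : ∀ {x y} → x ℕ.* x ≡ y ℕ.* y → x ≡ y
  square-injective {x} {y} eq with ℕ.<-cmp x y
  ... | tri< x<y _ _ = ⊥-elim (ℕ.<-irrefl eq (ℕ.*-mono-< x<y x<y))
  ... | tri≈ _ x≡y _ = x≡y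
  ... | tri> _ _ y<x = ⊥-elim (ℕ.<-irrefl (sym eq) (ℕ.*-mono-< y<x y<x))

lake-label : ∀ {m b c} → disc [ + 0 , b , c ] ≡ + (m ℕ.* m) → b ≡ + m ⊎ b ≡ - + m
lake-label {m} {b} {c} disc≡
  with square-injective {ℤ.∣ b ∣} {m} (trans (sym (ℤ.abs-* b b)) (cong ℤ.∣_∣ b*b≡))
  where
  identity : ∀ b c → b * b ≡ b * b - + 4 * + 0 * c
  identity = solve-∀
  b*b≡ : b * b ≡ + (m ℕ.* m)
  b*b≡ = trans (identity b c) disc≡
... | refl =
  Sum.map sym (λ eq → trans (sym (ℤ.neg-involutive b)) (cong -_ (sym eq))) (ℤ.+∣i∣≡i⊎+∣i∣≡-i b)

FactorsWithDet : ℤ → Config → ℤ → ℤ → Set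
FactorsWithDet m k γ δ = ∃[ α ] ∃[ β ] (k ≡ factored α β γ δ × α * δ - β * γ ≡ m)

factorsWithDet-action : ∀ m → CoordinateAction (FactorsWithDet m)
factorsWithDet-action m = record
  { leftMove-act    = λ { {γ = γ} {δ} (α , β , refl , det≡) →
      α , α + β , factored-leftMove α β γ δ , trans (det-leftMove α β γ δ) det≡ }
  ; rightMove-act   = λ { {γ = γ} {δ} (α , β , refl , det≡) →
      α + β , β , factored-rightMove α β γ δ , trans (det-rightMove α β γ δ) det≡ }
  ; reverseMove-act = λ { {γ = γ} {δ} (α , β , refl , det≡) →
      β , - α , factored-reverseMove α β γ δ , trans (det-reverseMove α β γ δ) det≡ }
  }

-- The two lakes carry labels m and -m; the factorization y (-(1 + n) x + c y),
-- of determinant 1 + n, is carried across to the other lake.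
lake-flip : ∀ n c → ∃[ c′ ] [ + 0 , -[1+ n ] , c ] ≈ [ + 0 , +[1+ n ] , c′ ]
lake-flip n c with Descent.descend (factorsWithDet-action +[1+ n ]) {γ = -[1+ n ]} (λ ())
  (+ 0 , + 1 , config-cong (left≡ -[1+ n ]) (label≡ -[1+ n ] c) (right≡ c) , det≡ -[1+ n ] c)
  where
  left≡ : ∀ γ → + 0 ≡ + 0 * γ
  left≡ = solve-∀
  label≡ : ∀ γ c → γ ≡ + 0 * c + + 1 * γ
  label≡ = solve-∀
  right≡ : ∀ c → c ≡ + 1 * c
  right≡ = solve-∀
  det≡ : ∀ γ c → + 0 * c - + 1 * γ ≡ - γ
  det≡ = solve-∀
... | k′ , d , k≈k′ , α , β , refl , det≡ =
  β * -[1+ d ] , ≈-trans k≈k′ (≡⇒≈ (cong₂ [_,_, _ ] (left≡ α) (trans (label≡ α β -[1+ d ]) det≡)))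
  where
  left≡ : ∀ α → α * + 0 ≡ + 0
  left≡ = solve-∀
  label≡ : ∀ α β δ → α * δ + β * + 0 ≡ α * δ - β * + 0
  label≡ = solve-∀

positiveLake-reachable : ∀ {k m} → disc k ≡ + (suc m ℕ.* suc m) → ∃[ c ] k ≈ [ + 0 , +[1+ m ] , c ]
positiveLake-reachable {k} {m} disc≡ with lake-reachable {k} {suc m} disc≡
... | [ .(+ 0) , b , c ] , k≈k′ , refl
  with lake-label {suc m} {b} {c} (transport (disc-invariant _) k≈k′ disc≡)
...   | inj₁ refl = c , k≈k′
...   | inj₂ refl = Product.map₂ (≈-trans k≈k′) (lake-flip m c)

lake-shift : ∀ M c q → [ + 0 , M , c ] ≈ [ + 0 , M , c + q * M ]
lake-shift M c (+ n)    = shiftℕ n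
  where
  shiftℕ : ∀ n → [ + 0 , M , c ] ≈ [ + 0 , M , c + + n * M ]
  shiftℕ zero    = ≡⇒≈ (cong [ + 0 , M ,_] (sym (ℤ.+-identityʳ c)))
  shiftℕ (suc n) = ≈-trans (shiftℕ n) (≈-trans (≈-leftMove _)
    (≡⇒≈ (config-cong refl (label≡ M) (right≡ c (+ n) M))))
    where
    label≡ : ∀ M → + 2 * + 0 + M ≡ M
    label≡ = solve-∀
    right≡ : ∀ c N M → + 0 + M + (c + N * M) ≡ c + (+ 1 + N) * M
    right≡ = solve-∀
lake-shift M c -[1+ n ] = ≈-sym (≈-trans (lake-shift M (c + -[1+ n ] * M) +[1+ n ])
  (≡⇒≈ (cong [ + 0 , M ,_] (cancel c +[1+ n ] M))))
  where
  cancel : ∀ c N M → c + - N * M + N * M ≡ c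
  cancel = solve-∀

lake-reduce : ∀ m c → [ + 0 , +[1+ m ] , c ] ≈ [ + 0 , +[1+ m ] , + (c %ℕ suc m) ]
lake-reduce m c = ≈-sym (≈-trans (lake-shift +[1+ m ] (+ (c %ℕ suc m)) (c /ℕ suc m))
  (≡⇒≈ (cong [ + 0 , +[1+ m ] ,_] (sym (a≡a%ℕn+[a/ℕn]*n c (suc m))))))

lake≈riverStart : ∀ x y → [ + 0 , x + y , y ] ≈ riverStart x y
lake≈riverStart x y = ≈-trans (≈-reverseMove _) (≈-trans (≈-leftMove _)
  (≡⇒≈ (config-cong refl (label≡ x y) (right≡ x y))))
  where
  label≡ : ∀ x y → + 2 * y + - (x + y) ≡ y - x
  label≡ = solve-∀
  right≡ : ∀ x y → y + - (x + y) + + 0 ≡ - x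
  right≡ = solve-∀

≈riverStart⇒riverSequence : ∀ {k} x y → k ≈ riverStart +[1+ x ] +[1+ y ] → ∃[ w ] RiverSequence k w
≈riverStart⇒riverSequence x y k≈start = Product.map₂
  (λ walk → _ , k≈start , riverStart-tailRegion +[1+ x ] +[1+ y ] , walk)
  (riverWalk-exists x y (riverStart-riverEdge x y) (riverStart-vanishes +[1+ x ] +[1+ y ]))

riverSequence-exists : ∀ {k} → PrimSquare k → ∃[ w ] RiverSequence k w
riverSequence-exists (_ , zero , _ , ())
riverSequence-exists {k} (k-primitive , suc m , disc≡ , 4≤m²)
  with positiveLake-reachable {k} {m} disc≡
... | c , k≈lake with c %ℕ suc m | n%ℕd<d c (suc m) | ≈-trans k≈lake (lake-reduce m c)
...   | zero  | _   | k≈[0,M,0] = ⊥-elim (m²≮4 (cong (λ n → n ℕ.* n)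
  (primitive-commonDivisor k-primitive k≈[0,M,0] (suc m) (∣0 , ∣-refl , ∣0))))
  where
  ∣0 : +[1+ m ] ∣ + 0
  ∣0 = divides (+ 0) refl
  m²≮4 : suc m ℕ.* suc m ≢ 1
  m²≮4 eq with subst (4 ℕ.≤_) eq 4≤m²
  ... | s≤s ()
...   | suc y | y<m | k≈[0,M,r] = ≈riverStart⇒riverSequence x y
  (≈-trans k≈[0,M,r] (≈-trans (≡⇒≈ (cong (λ n → [ + 0 , + n , +[1+ y ] ]) (sym x+y≡m)))
                              (lake≈riverStart _ _)))
  where
  x : ℕ
  x = m ℕ.∸ suc y
  x+y≡m : suc x ℕ.+ suc y ≡ suc m
  x+y≡m = cong suc (ℕ.m∸n+n≡m (ℕ.≤-pred y<m))


-- The first river edge is determined by the river sequence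

private
  i+j≡0⇒i≡-j : ∀ {i j} → i + j ≡ + 0 → i ≡ - j
  i+j≡0⇒i≡-j {i} {j} i+j≡0 = trans (identity i j) (trans (cong (_- j) i+j≡0) (ℤ.+-identityˡ (- j)))
    where
    identity : ∀ i j → i ≡ i + j - j
    identity = solve-∀

proportional-coprime : ∀ {a c x y} → Coprime (suc x) (suc y) → a ℕ.* suc x ≡ c ℕ.* suc y →
  ∃[ t ] (c ≡ t ℕ.* suc x × a ≡ t ℕ.* suc y)
proportional-coprime {a} {c} {x} {y} coprime ax≡cy with
  Coprime.coprime-divisor coprime (ℕ.divides a (trans (ℕ.*-comm (suc y) c) (sym ax≡cy)))
... | ℕ.divides t c≡tx = t , c≡tx , ℕ.*-cancelʳ-≡ a (t ℕ.* suc y) (suc x) (begin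
  a ℕ.* suc x             ≡⟨ ax≡cy ⟩
  c ℕ.* suc y             ≡⟨ cong (ℕ._* suc y) c≡tx ⟩
  t ℕ.* suc x ℕ.* suc y   ≡⟨ ℕ.*-assoc t (suc x) (suc y) ⟩
  t ℕ.* (suc x ℕ.* suc y) ≡⟨ cong (t ℕ.*_) (ℕ.*-comm (suc x) (suc y)) ⟩
  t ℕ.* (suc y ℕ.* suc x) ≡⟨ ℕ.*-assoc t (suc y) (suc x) ⟨
  t ℕ.* suc y ℕ.* suc x   ∎)
  where open ≡-Reasoning

riverWalk-riverEdge : ∀ {k w} → RiverWalk k w → RiverEdge k
riverWalk-riverEdge (end _ e _)   = e
riverWalk-riverEdge (stepL _ e _) = e
riverWalk-riverEdge (stepR _ e _) = e

-- With tail region 0 the form is (x + y) (a x + c y); its zero (1 + p, 1 + q)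
-- fixes a : c, and primitivity kills the common factor.
lakeEdge-determined : ∀ a c p q → Coprime (suc p) (suc q) →
  value [ +[1+ a ] , +[1+ a ] + -[1+ c ] , -[1+ c ] ] +[1+ p ] +[1+ q ] ≡ + 0 →
  (∀ t → CommonDivisor (+ t) [ +[1+ a ] , +[1+ a ] + -[1+ c ] , -[1+ c ] ] → t ≡ 1) →
  a ≡ q × c ≡ p
lakeEdge-determined a c p q coprime v≡0 no-divisor
  with ℤ.i*j≡0⇒i≡0∨j≡0 (X + Y) (trans (factorise +[1+ a ] -[1+ c ] X Y) v≡0)
  where
  X Y : ℤ
  X = +[1+ p ]
  Y = +[1+ q ]
  factorise : ∀ a c X Y → (X + Y) * (a * X + c * Y) ≡ a * X * X + (a + c) * X * Y + c * Y * Y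
  factorise = solve-∀
... | inj₂ ax+cy≡0
  with proportional-coprime coprime (ℤ.+-injective (i+j≡0⇒i≡-j {j = -[1+ c ] * +[1+ q ]} ax+cy≡0))
... | t , c≡tp , a≡tq with no-divisor t (t∣ c≡tp a≡tq)
  where
  t∣ : suc c ≡ t ℕ.* suc p → suc a ≡ t ℕ.* suc q →
       CommonDivisor (+ t) [ +[1+ a ] , +[1+ a ] + -[1+ c ] , -[1+ c ] ]
  t∣ c≡tp a≡tq = t∣a , ∣m∣n⇒∣m+n t∣a t∣c , t∣c
    where
    t∣a : + t ∣ +[1+ a ]
    t∣a = ∣ᵤ⇒∣ (ℕ.divides (suc q) (trans a≡tq (ℕ.*-comm t (suc q))))
    t∣c : + t ∣ -[1+ c ]
    t∣c = ∣ᵤ⇒∣ (ℕ.divides (suc p) (trans c≡tp (ℕ.*-comm t (suc p))))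
... | refl = ℕ.suc-injective (trans a≡tq (ℕ.*-identityˡ (suc q))) ,
             ℕ.suc-injective (trans c≡tp (ℕ.*-identityˡ (suc p)))

riverWalk⇒≡firstRiverEdge : ∀ {k w} → tailRegion k ≡ + 0 → RiverWalk k w →
  (∀ t → CommonDivisor (+ t) k → t ≡ 1) → k ≡ firstRiverEdge w
riverWalk⇒≡firstRiverEdge {[ a , b , c ]} {w} tail≡0 walk no-divisor with riverWalk-riverEdge walk
... | +<+ (s≤s z≤n) , -<+ with ℤ.i-j≡0⇒i≡j (a + c) b tail≡0
... | refl with lakeEdge-determined _ _ _ _ (sternBrocot-coprime w) (riverWalk-vanishes walk) no-divisor
... | refl , refl = refl

riverSequence⇒≈firstRiverEdge : ∀ {k w} → Primitive k → RiverSequence k w → k ≈ firstRiverEdge w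
riverSequence⇒≈firstRiverEdge k-primitive (k′ , k≈k′ , tail≡0 , walk) =
  ≈-trans k≈k′ (≡⇒≈ (riverWalk⇒≡firstRiverEdge tail≡0 walk (primitive-commonDivisor k-primitive k≈k′)))


-- Distinct words give distinct topographs

FactorsWithResidue : ℤ → ℤ → Config → Set
FactorsWithResidue M r k = ∃[ α ] ∃[ β ] ∃[ γ ] ∃[ δ ]
  (k ≡ factored α β γ δ × α * δ - β * γ ≡ M × M ∣ α - r * γ × M ∣ β - r * δ)

factorsWithResidue-invariant : ∀ M r → MoveInvariant (FactorsWithResidue M r)
factorsWithResidue-invariant M r = record
  { reverseMove-pres = λ { (α , β , γ , δ , refl , det≡ , M∣α′ , M∣β′) →
      β , - α , δ , - γ , factored-reverseMove α β γ δ , trans (det-reverseMove α β γ δ) det≡ ,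
      M∣β′ , subst (M ∣_) (residue-neg r α γ) (∣m⇒∣-m M∣α′) }
  ; leftMove-pres    = λ { (α , β , γ , δ , refl , det≡ , M∣α′ , M∣β′) →
      α , α + β , γ , γ + δ , factored-leftMove α β γ δ , trans (det-leftMove α β γ δ) det≡ ,
      M∣α′ , subst (M ∣_) (residue-+ r α β γ δ) (∣m∣n⇒∣m+n M∣α′ M∣β′) }
  ; rightMove-pres   = λ { (α , β , γ , δ , refl , det≡ , M∣α′ , M∣β′) →
      α + β , β , γ + δ , δ , factored-rightMove α β γ δ , trans (det-rightMove α β γ δ) det≡ ,
      subst (M ∣_) (residue-+ r α β γ δ) (∣m∣n⇒∣m+n M∣α′ M∣β′) , M∣β′ }
  }
  where
  residue-neg : ∀ r α γ → - (α - r * γ) ≡ - α - r * - γ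
  residue-neg = solve-∀
  residue-+ : ∀ r α β γ δ → (α - r * γ) + (β - r * δ) ≡ (α + β) - r * (γ + δ)
  residue-+ = solve-∀

riverStart-residue : ∀ x y → FactorsWithResidue (x + y) y (riverStart x y)
riverStart-residue x y =
  y , - x , + 1 , + 1 , config-cong (left≡ y) (label≡ x y) (left≡ (- x)) , det≡ x y ,
  divides (+ 0) (α′≡ x y) , divides (- + 1) (β′≡ x y)
  where
  left≡ : ∀ y → y ≡ y * + 1
  left≡ = solve-∀
  label≡ : ∀ x y → y - x ≡ y * + 1 + - x * + 1
  label≡ = solve-∀
  det≡ : ∀ x y → y * + 1 - - x * + 1 ≡ x + y
  det≡ = solve-∀
  α′≡ : ∀ x y → y - y * + 1 ≡ + 0 * (x + y)
  α′≡ = solve-∀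
  β′≡ : ∀ x y → - x - y * + 1 ≡ - + 1 * (x + y)
  β′≡ = solve-∀

∣a-b⇒a≡b : ∀ {m a b} → + m ∣ + a - + b → a ℕ.< m → b ℕ.< m → a ≡ b
∣a-b⇒a≡b {m} {a} {b} m∣a-b a<m b<m =
  ℤ.+-injective (ℤ.i-j≡0⇒i≡j _ _ (ℤ.∣i∣≡0⇒i≡0 (small-multiple ∣a-b∣<m (∣⇒∣ᵤ m∣a-b))))
  where
  ∣a-b∣<m : ℤ.∣ + a - + b ∣ ℕ.< m
  ∣a-b∣<m = ℕ.≤-<-trans (subst (ℕ._≤ a ℕ.⊔ b) (cong ℤ.∣_∣ (sym (ℤ.m-n≡m⊖n a b))) (ℤ.∣m⊝n∣≤m⊔n a b))
                         (ℕ.⊔-lub a<m b<m)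
  small-multiple : ∀ {n} → n ℕ.< m → m ℕ.∣ n → n ≡ 0
  small-multiple {zero}  _   _   = refl
  small-multiple {suc n} n<m m∣n = ⊥-elim (ℕ.>⇒∤ n<m m∣n)

-- The form of riverStart x y is (x′ + y′) (y x′ - x y′), which vanishes at (1, -1);
-- so one factor of any factorization vanishes there too, and it cannot be α x′ + β y′
-- since the determinant would then be -(x + y).
riverStart-factorization : ∀ {x y m α β γ δ} → riverStart +[1+ x ] +[1+ y ] ≡ factored α β γ δ →
  α * δ - β * γ ≡ +[1+ m ] → γ ≡ δ × +[1+ m ] ≡ +[1+ x ] + +[1+ y ]
riverStart-factorization {x} {y} {m} {α} {β} {γ} {δ} eq det≡ =
  [ (λ α-β≡0 → ⊥-elim (α≢β (ℤ.i-j≡0⇒i≡j α β (trans (difference α β) α-β≡0))))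
  , (λ γ-δ≡0 → diagonal (ℤ.i-j≡0⇒i≡j γ δ (trans (difference γ δ) γ-δ≡0)))
  ]′ (ℤ.i*j≡0⇒i≡0∨j≡0 (α * + 1 + β * - + 1) (begin
    (α * + 1 + β * - + 1) * (γ * + 1 + δ * - + 1) ≡⟨ value-factored α β γ δ (+ 1) (- + 1) ⟨
    value (factored α β γ δ) (+ 1) (- + 1)        ≡⟨ cong (λ k → value k (+ 1) (- + 1)) eq ⟨
    value (riverStart X Y) (+ 1) (- + 1)          ≡⟨ antidiagonal X Y ⟩
    + 0                                           ∎))
  where
  open ≡-Reasoning
  X Y : ℤ
  X = +[1+ x ]
  Y = +[1+ y ]
  antidiagonal : ∀ X Y → Y * + 1 * + 1 + (Y - X) * + 1 * - + 1 + - X * - + 1 * - + 1 ≡ + 0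
  antidiagonal = solve-∀
  difference : ∀ a b → a - b ≡ a * + 1 + b * - + 1
  difference = solve-∀
  split : ∀ α β γ δ → α * δ - β * γ ≡ (α * δ + β * γ) - + 2 * (β * γ)
  split = solve-∀
  collect : ∀ X Y → (Y - X) - + 2 * Y ≡ - (X + Y)
  collect = solve-∀
  collect′ : ∀ X Y → Y - - X ≡ X + Y
  collect′ = solve-∀
  negative : +[1+ m ] ≢ - (X + Y)
  negative ()
  α≢β : α ≢ β
  α≢β α≡β = negative (begin
    +[1+ m ]                          ≡⟨ det≡ ⟨
    α * δ - β * γ                     ≡⟨ split α β γ δ ⟩
    (α * δ + β * γ) - + 2 * (β * γ)   ≡⟨ cong₂ (λ l r → l - + 2 * r) (cong label eq) (cong (_* γ) α≡β) ⟨
    (Y - X) - + 2 * (α * γ)           ≡⟨ cong (λ l → (Y - X) - + 2 * l) (cong left eq) ⟨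
    (Y - X) - + 2 * Y                 ≡⟨ collect X Y ⟩
    - (X + Y)                         ∎)
  diagonal : γ ≡ δ → γ ≡ δ × +[1+ m ] ≡ X + Y
  diagonal γ≡δ = γ≡δ , (begin
    +[1+ m ]        ≡⟨ det≡ ⟨
    α * δ - β * γ   ≡⟨ cong₂ (λ d g → α * d - β * g) (sym γ≡δ) γ≡δ ⟩
    α * γ - β * δ   ≡⟨ cong₂ _-_ (cong left eq) (cong right eq) ⟨
    Y - - X         ≡⟨ collect′ X Y ⟩
    X + Y           ∎)

unit-cofactor : ∀ {m u γ} → +[1+ m ] ∣ u → u * γ ≡ +[1+ m ] → γ * γ ≡ + 1
unit-cofactor {m} {u} {γ} (divides j u≡jM) uγ≡M =
  square-of-unit γ (ℕ.m*n≡1⇒n≡1 ℤ.∣ j ∣ ℤ.∣ γ ∣ (trans (sym (ℤ.abs-* j γ)) (cong ℤ.∣_∣ jγ≡1)))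
  where
  open ≡-Reasoning
  M : ℤ
  M = +[1+ m ]
  swap : ∀ j γ M → j * γ * M ≡ j * M * γ
  swap = solve-∀
  jγ≡1 : j * γ ≡ + 1
  jγ≡1 = ℤ.*-cancelʳ-≡ (j * γ) (+ 1) M (begin
    j * γ * M   ≡⟨ swap j γ M ⟩
    j * M * γ   ≡⟨ cong (_* γ) u≡jM ⟨
    u * γ       ≡⟨ uγ≡M ⟩
    M           ≡⟨ ℤ.*-identityˡ M ⟨
    + 1 * M     ∎)
  square-of-unit : ∀ γ → ℤ.∣ γ ∣ ≡ 1 → γ * γ ≡ + 1
  square-of-unit +[1+ zero ]  _ = refl
  square-of-unit -[1+ zero ]  _ = refl
  square-of-unit (+ zero)     ()
  square-of-unit +[1+ suc _ ] ()
  square-of-unit -[1+ suc _ ] ()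

-- The residue is y₂ up to the factor γ² = 1, and 0 < y₁, y₂ < x₁ + y₁.
residue-determines : ∀ {x₁ y₁ x₂ y₂} →
  FactorsWithResidue (+[1+ x₁ ] + +[1+ y₁ ]) +[1+ y₁ ] (riverStart +[1+ x₂ ] +[1+ y₂ ]) → x₁ ≡ x₂ × y₁ ≡ y₂
residue-determines {x₁} {y₁} {x₂} {y₂} (α , β , γ , δ , eq , det≡ , M∣α′ , M∣β′)
  with riverStart-factorization {α = α} {β} {γ} {δ} eq det≡
... | refl , M≡ = x₁≡x₂ , y₁≡y₂
  where
  open ≡-Reasoning
  M Y₁ : ℤ
  M = +[1+ x₁ ] + +[1+ y₁ ]
  Y₁ = +[1+ y₁ ]
  difference : ∀ r α β γ → (α - r * γ) - (β - r * γ) ≡ α - β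
  difference = solve-∀
  distrib : ∀ α β γ → (α - β) * γ ≡ α * γ - β * γ
  distrib = solve-∀
  expand : ∀ r α γ → γ * (α - r * γ) ≡ α * γ - r * (γ * γ)
  expand = solve-∀
  γ²≡1 : γ * γ ≡ + 1
  γ²≡1 = unit-cofactor (subst (M ∣_) (difference Y₁ α β γ) (∣m∣n⇒∣m-n M∣α′ M∣β′))
                       (trans (distrib α β γ) det≡)
  M∣y₂-y₁ : M ∣ +[1+ y₂ ] - Y₁
  M∣y₂-y₁ = subst (M ∣_) (begin
    γ * (α - Y₁ * γ)       ≡⟨ expand Y₁ α γ ⟩
    α * γ - Y₁ * (γ * γ)   ≡⟨ cong₂ (λ l s → l - Y₁ * s) (cong left eq) (sym γ²≡1) ⟨
    +[1+ y₂ ] - Y₁ * + 1   ≡⟨ cong (λ s → +[1+ y₂ ] - s) (ℤ.*-identityʳ Y₁) ⟩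
    +[1+ y₂ ] - Y₁         ∎) (∣n⇒∣m*n γ M∣α′)
  m≡ : suc x₁ ℕ.+ suc y₁ ≡ suc x₂ ℕ.+ suc y₂
  m≡ = ℤ.+-injective M≡
  y₁≡y₂ : y₁ ≡ y₂
  y₁≡y₂ = sym (ℕ.suc-injective (∣a-b⇒a≡b M∣y₂-y₁
    (subst (suc y₂ ℕ.<_) (sym m≡) (ℕ.m<n+m (suc y₂) (s≤s z≤n))) (ℕ.m<n+m (suc y₁) (s≤s z≤n))))
  x₁≡x₂ : x₁ ≡ x₂
  x₁≡x₂ = ℕ.suc-injective (ℕ.+-cancelʳ-≡ _ _ _ (trans m≡ (cong (λ y → suc x₂ ℕ.+ suc y) (sym y₁≡y₂))))

firstRiverEdge-injective : ∀ w w′ → firstRiverEdge w ≈ firstRiverEdge w′ → w ≡ w′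
firstRiverEdge-injective w w′ edges≈ =
  sternBrocot-injective w w′ (cong₂ _,_ (proj₁ same-pair) (proj₂ same-pair))
  where
  x y x′ y′ : ℕ
  x = proj₁ (sternBrocot w)
  y = proj₂ (sternBrocot w)
  x′ = proj₁ (sternBrocot w′)
  y′ = proj₂ (sternBrocot w′)
  same-pair : x ≡ x′ × y ≡ y′
  same-pair = residue-determines {x} {y} {x′} {y′}
    (transport (factorsWithResidue-invariant (+[1+ x ] + +[1+ y ]) +[1+ y ]) edges≈
               (riverStart-residue +[1+ x ] +[1+ y ]))

theorem8p15 :
    (∀ k → PrimSquare k → ∃[ w ] (RiverSequence k w × (∀ w' → RiverSequence k w' → w' ≡ w)))
    × (∀ (w : Word) → ∃[ k ] (PrimSquare k × RiverSequence k w))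
    × (∀ k k' (w : Word) → PrimSquare k → PrimSquare k' → RiverSequence k w → RiverSequence k' w → SameTopograph k k')
theorem8p15 = well-defined , surjective , injective
  where
  well-defined : ∀ k → PrimSquare k → ∃[ w ] (RiverSequence k w × (∀ w′ → RiverSequence k w′ → w′ ≡ w))
  well-defined k k-primSquare@(k-primitive , _) with riverSequence-exists k-primSquare
  ... | w , rs = w , rs , λ w′ rs′ → firstRiverEdge-injective w′ w (≈-trans (≈-sym (≈first rs′)) (≈first rs))
    where
    ≈first : ∀ {w} → RiverSequence k w → k ≈ firstRiverEdge w
    ≈first = riverSequence⇒≈firstRiverEdge k-primitive
  surjective : ∀ w → ∃[ k ] (PrimSquare k × RiverSequence k w)
  surjective w = firstRiverEdge w , firstRiverEdge-primSquare w , firstRiverEdge-riverSequence w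
  injective : ∀ k k′ w → PrimSquare k → PrimSquare k′ → RiverSequence k w → RiverSequence k′ w → k ≈ k′
  injective k k′ w (k-primitive , _) (k′-primitive , _) rs rs′ =
    ≈-trans (riverSequence⇒≈firstRiverEdge k-primitive rs)
            (≈-sym (riverSequence⇒≈firstRiverEdge k′-primitive rs′))
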